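{- Let $k,\ell\ge 2$ and suppose that every Boolean degree $1$ function on $J(k+\ell,k)$ is constant or equal to $x^\pm$ for some element $x$ of the ground set. Let $f$ be a Boolean degree $1$ function on $J(k+\ell+1,k+1)$ with ground set $[k+\ell+1]$. Then for any $a\neq b$ in $[k+\ell+1]$, one of the following holds: (1) $f_a=f_b$ is the same constant ($1^+$ or $1^-$); (2) $f_a=f_b=x^\pm$ (same sign) for some $x\neq a,b$; (3) $f_a=1^\pm$ and $f_b=a^\pm$ with the same sign, or vice versa ($f_b=1^\pm$ and $f_a=b^\pm$ with the same sign).
   Context: $J(n,k)$ is the set of all $k$-subsets of an $n$-element ground set. For an element $x$, $x^+(S)=1$ if $x\in S$ and $0$ otherwise, $x^-=1-x^+$; $1^+$ is the constant function $1$ and $1^-$ the constant $0$. A Boolean degree $1$ function on $J(n,k)$ is a function $f$ with values in $\{0,1\}$ that can be written as $c+\sum_i c_i x_i^+$ with real constants. For $a$ in the ground set, $f_a$ is the restriction of $f$ to the sets containing $a$ (a domain isomorphic to $J(k+\ell,k)$ with ground set $[k+\ell+1]\setminus\{a\}$); $f_a=g$ means $f(S)=g(S)$ for all $S\ni a$.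
   Formalization: The constants $c$ and $c_i$ in the definition of a Boolean degree $1$ function are rational rather than real. -}

module Defs where

open import Data.Bool using (Bool; true; false; not; if_then_else_)
open import Data.Nat using (ℕ; zero; suc)
open import Data.Fin using (Fin; zero; suc)
open import Data.Fin.Subset using (Subset; ∣_∣)
open import Data.Vec using (lookup)
open import Data.Rational using (ℚ; 0ℚ; 1ℚ; _+_; _*_)
open import Data.Product using (Σ; ∃; _×_)
open import Data.Sum using (_⊎_)
open import Relation.Binary.PropositionalEquality using (_≡_)

mem : ∀ {n} → Fin n → Subset n → Bool
mem x S = lookup S x

ind : Bool → ℚ
ind b = if b then 1ℚ else 0ℚ

sumFin : ∀ n → (Fin n → ℚ) → ℚ
sumFin zero    g = 0ℚ
sumFin (suc n) g = g zero + sumFin n (λ i → g (suc i))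

-- Boolean degree 1 function on J(n,k): f : Subset n → Bool, considered only on
-- k-subsets, such that f = c + Σ_i c_i x_i⁺ on J(n,k).
IsBoolDeg1 : (n k : ℕ) → (Subset n → Bool) → Set
IsBoolDeg1 n k f =
  Σ ℚ λ c → Σ (Fin n → ℚ) λ cs →
    ∀ (S : Subset n) → ∣ S ∣ ≡ k →
      ind (f S) ≡ c + sumFin n (λ i → cs i * ind (mem i S))

lit : ∀ {n} → Bool → Fin n → Subset n → Bool
lit true  x S = mem x S
lit false x S = not (mem x S)

-- signed constant: 1⁺ = constant 1 (true), 1⁻ = constant 0 (false)
-- (represented directly by the Bool value s)

EqOn : (n k : ℕ) → (Subset n → Bool) → (Subset n → Bool) → Set
EqOn n k f g = ∀ (S : Subset n) → ∣ S ∣ ≡ k → f S ≡ g S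

EqRestr : (n k : ℕ) → (Subset n → Bool) → Fin n → (Subset n → Bool) → Set
EqRestr n k f a g = ∀ (S : Subset n) → ∣ S ∣ ≡ k → mem a S ≡ true → f S ≡ g S

OnlyTrivial : (n k : ℕ) → Set
OnlyTrivial n k =
  ∀ (g : Subset n → Bool) → IsBoolDeg1 n k g →
    (Σ Bool λ s → EqOn n k g (λ _ → s))
    ⊎ (Σ Bool λ s → Σ (Fin n) λ x → EqOn n k g (lit s x))

module Submission where

-- For every point c, deleting c identifies the (k+1)-sets through c with J(k+ℓ, k),
-- and f_c becomes a Boolean degree-1 function there; by hypothesis it is a constant or
-- a signed literal x^± with x ≠ c.
-- Both f_a and f_b describe f on the K-sets through a and b.  On those sets a literal on
-- a or b is a constant, and two forms avoiding a and b that agree on all K-sets through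
-- a and b are equal (separate), because K-sets with up to three prescribed members and
-- two prescribed non-members exist when K ≥ 3 and n - K ≥ 2 (choose).  This leaves five
-- shapes for (f_a, f_b) (Compatible): four are the alternatives of the lemma, and the
-- fifth, f_a = b^s together with f_b = a^s, is refuted with a third point c (no-crossing).

open import Defs
open import Data.Bool using (Bool; true; false; not; T)
open import Data.Bool.Properties using (¬-not; not-¬; not-injective)
open import Data.Nat using (ℕ; zero; suc; _+_; _∸_; _≤_; _≤ᵇ_; z≤n; s≤s)
open import Data.Nat.Properties as ℕ
  using (≤-trans; ≤-reflexive; +-suc; +-monoˡ-≤; +-monoʳ-≤; _<?_; ≮⇒≥; <⇒≢;
         m+n≤o⇒m≤o∸n; ∸-monoʳ-≤; ≤ᵇ⇒≤; module ≤-Reasoning)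
open import Data.Fin using (Fin; zero; suc; punchIn)
open import Data.Fin.Properties using (_≟_; punchInᵢ≢i)
open import Data.Fin.Subset using (Subset; ∣_∣; _∈_; _⊆_; _∪_; ⁅_⁆; ∁) renaming (⊥ to ∅)
open import Data.Fin.Subset.Properties
  using (drop-∷-⊆; s⊆s; out⊆; p⊆q⇒∣p∣≤∣q∣; ∣p∣≤∣x∷p∣; ∣⊥∣≡0; ∉⊥; x∈⁅x⁆; x∈⁅y⁆⇒x≡y;
         ∣⁅x⁆∣≡1; x∈p∪q⁺; x∈p∪q⁻; x∉p⇒x∈∁p; x∈∁p⇒x∉p; ∣∁p∣≡n∸∣p∣; nonempty?; Empty-unique)
open import Data.Vec using ([]; _∷_; here; insertAt; removeAt)
open import Data.Vec.Properties
  using ([]=⇒lookup; lookup⇒[]=; insertAt-lookup; insertAt-punchIn; insertAt-removeAt)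
open import Data.List using (List; []; _∷_; foldr; length)
open import Data.List.Membership.Propositional renaming (_∈_ to _∈ˡ_)
open import Data.List.Relation.Unary.Any as Any using ()
open import Data.List.Relation.Unary.All as All using (All; []; _∷_)
open import Data.Rational as ℚ using (ℚ; 1ℚ)
import Data.Rational.Properties as ℚ
open import Data.Unit using (⊤)
open import Data.Product using (Σ; Σ-syntax; _×_; _,_)
open import Data.Sum using (_⊎_; inj₁; inj₂)
open import Data.Empty using (⊥; ⊥-elim)
open import Relation.Nullary using (yes; no)
open import Relation.Binary.PropositionalEquality
  using (_≡_; _≢_; refl; sym; trans; cong; cong₂; ≢-sym; module ≡-Reasoning)

∣p∪q∣≤∣p∣+∣q∣ : ∀ {n} (p q : Subset n) → ∣ p ∪ q ∣ ≤ ∣ p ∣ + ∣ q ∣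
∣p∪q∣≤∣p∣+∣q∣ []          []         = z≤n
∣p∪q∣≤∣p∣+∣q∣ (true ∷ p)  (s ∷ q)    =
  s≤s (≤-trans (∣p∪q∣≤∣p∣+∣q∣ p q) (+-monoʳ-≤ ∣ p ∣ (∣p∣≤∣x∷p∣ s q)))
∣p∪q∣≤∣p∣+∣q∣ (false ∷ p) (true ∷ q)  =
  ≤-trans (s≤s (∣p∪q∣≤∣p∣+∣q∣ p q)) (≤-reflexive (sym (+-suc ∣ p ∣ ∣ q ∣)))
∣p∪q∣≤∣p∣+∣q∣ (false ∷ p) (false ∷ q) = ∣p∪q∣≤∣p∣+∣q∣ p q

-- An element of Q ∖ P is taken exactly when the elements of P still to come
-- cannot fill the remaining quota on their own.
between : ∀ {n} K (P Q : Subset n) → P ⊆ Q → ∣ P ∣ ≤ K → K ≤ ∣ Q ∣ →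
          Σ[ S ∈ Subset n ] ∣ S ∣ ≡ K × P ⊆ S × S ⊆ Q
between zero    []          []          _   _         _         = [] , refl , (λ ()) , (λ ())
between (suc K) []          []          _   _         ()
between K       (true ∷ P)  (false ∷ Q) P⊆Q _         _         with P⊆Q here
... | ()
between (suc K) (true ∷ P)  (true ∷ Q)  P⊆Q (s≤s P≤K) (s≤s K≤Q)
  with between K P Q (drop-∷-⊆ P⊆Q) P≤K K≤Q
... | S , ∣S∣≡K , P⊆S , S⊆Q = true ∷ S , cong suc ∣S∣≡K , s⊆s P⊆S , s⊆s S⊆Q
between K       (false ∷ P) (false ∷ Q) P⊆Q P≤K       K≤Q
  with between K P Q (drop-∷-⊆ P⊆Q) P≤K K≤Q
... | S , ∣S∣≡K , P⊆S , S⊆Q = false ∷ S , ∣S∣≡K , s⊆s P⊆S , s⊆s S⊆Q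
between K       (false ∷ P) (true ∷ Q)  P⊆Q P≤K       K≤Q       with ∣ P ∣ <? K
between (suc K) (false ∷ P) (true ∷ Q)  P⊆Q _         (s≤s K≤Q) | yes (s≤s P≤K)
  with between K P Q (drop-∷-⊆ P⊆Q) P≤K K≤Q
... | S , ∣S∣≡K , P⊆S , S⊆Q = true ∷ S , cong suc ∣S∣≡K , out⊆ P⊆S , s⊆s S⊆Q
between K       (false ∷ P) (true ∷ Q)  P⊆Q P≤K       _         | no P≮K
  with between K P Q (drop-∷-⊆ P⊆Q) P≤K (≤-trans (≮⇒≥ P≮K) (p⊆q⇒∣p∣≤∣q∣ (drop-∷-⊆ P⊆Q)))
... | S , ∣S∣≡K , P⊆S , S⊆Q = false ∷ S , ∣S∣≡K , s⊆s P⊆S , out⊆ S⊆Q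

⟪_⟫ : ∀ {n} → List (Fin n) → Subset n
⟪ xs ⟫ = foldr (λ x p → ⁅ x ⁆ ∪ p) ∅ xs

∣⟪⟫∣≤length : ∀ {n} (xs : List (Fin n)) → ∣ ⟪ xs ⟫ ∣ ≤ length xs
∣⟪⟫∣≤length {n} []  = ≤-reflexive (∣⊥∣≡0 n)
∣⟪⟫∣≤length (x ∷ xs) = begin
  ∣ ⁅ x ⁆ ∪ ⟪ xs ⟫ ∣       ≤⟨ ∣p∪q∣≤∣p∣+∣q∣ ⁅ x ⁆ ⟪ xs ⟫ ⟩
  ∣ ⁅ x ⁆ ∣ + ∣ ⟪ xs ⟫ ∣  ≡⟨ cong (_+ ∣ ⟪ xs ⟫ ∣) (∣⁅x⁆∣≡1 x) ⟩
  suc ∣ ⟪ xs ⟫ ∣          ≤⟨ s≤s (∣⟪⟫∣≤length xs) ⟩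
  suc (length xs)          ∎
  where open ≤-Reasoning

∈⟪⟫⁺ : ∀ {n} {x : Fin n} {xs} → x ∈ˡ xs → x ∈ ⟪ xs ⟫
∈⟪⟫⁺ (Any.here refl)  = x∈p∪q⁺ (inj₁ (x∈⁅x⁆ _))
∈⟪⟫⁺ (Any.there x∈xs) = x∈p∪q⁺ (inj₂ (∈⟪⟫⁺ x∈xs))

∈⟪⟫⁻ : ∀ {n} {x : Fin n} xs → x ∈ ⟪ xs ⟫ → x ∈ˡ xs
∈⟪⟫⁻ []       x∈∅ = ⊥-elim (∉⊥ x∈∅)
∈⟪⟫⁻ (y ∷ xs) x∈  with x∈p∪q⁻ ⁅ y ⁆ ⟪ xs ⟫ x∈
... | inj₁ x∈⁅y⁆ = Any.here (x∈⁅y⁆⇒x≡y y x∈⁅y⁆)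
... | inj₂ x∈xs  = Any.there (∈⟪⟫⁻ xs x∈xs)

Disjoint : ∀ {n} → List (Fin n) → List (Fin n) → Set
Disjoint ins outs = All (λ y → All (y ≢_) ins) outs

-- A K-subset of [n] containing the elements of 'ins' and avoiding those of 'outs'
-- exists as soon as there is room for it: interpolate between ⟪ ins ⟫ and ∁ ⟪ outs ⟫.
choose : ∀ {n} K (ins outs : List (Fin n)) → length ins ≤ K → K + length outs ≤ n →
         Disjoint ins outs →
         Σ[ S ∈ Subset n ] ∣ S ∣ ≡ K × All (λ x → mem x S ≡ true) ins
                                     × All (λ y → mem y S ≡ false) outs
choose {n} K ins outs ins≤K K+outs≤n disjoint
  with between K ⟪ ins ⟫ (∁ ⟪ outs ⟫) ins⊆∁outs (≤-trans (∣⟪⟫∣≤length ins) ins≤K) K≤∣∁outs∣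
  where
  ins⊆∁outs : ⟪ ins ⟫ ⊆ ∁ ⟪ outs ⟫
  ins⊆∁outs x∈ins = x∉p⇒x∈∁p λ x∈outs →
    All.lookup (All.lookup disjoint (∈⟪⟫⁻ outs x∈outs)) (∈⟪⟫⁻ ins x∈ins) refl
  K≤∣∁outs∣ : K ≤ ∣ ∁ ⟪ outs ⟫ ∣
  K≤∣∁outs∣ = begin
    K                 ≤⟨ m+n≤o⇒m≤o∸n K K+outs≤n ⟩
    n ∸ length outs   ≤⟨ ∸-monoʳ-≤ n (∣⟪⟫∣≤length outs) ⟩
    n ∸ ∣ ⟪ outs ⟫ ∣   ≡⟨ sym (∣∁p∣≡n∸∣p∣ ⟪ outs ⟫) ⟩
    ∣ ∁ ⟪ outs ⟫ ∣     ∎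
    where open ≤-Reasoning
... | S , ∣S∣≡K , ins⊆S , S⊆∁outs =
  S , ∣S∣≡K ,
  All.tabulate (λ x∈ins → []=⇒lookup (ins⊆S (∈⟪⟫⁺ x∈ins))) ,
  All.tabulate (λ y∈outs → ¬-not λ y∈S →
    x∈∁p⇒x∉p (S⊆∁outs (lookup⇒[]= _ S y∈S)) (∈⟪⟫⁺ y∈outs))

data Form (n : ℕ) : Set where
  constF : Bool → Form n
  litF   : Bool → Fin n → Form n

⟦_⟧ : ∀ {n} → Form n → Subset n → Bool
⟦ constF s ⟧ S = s
⟦ litF s x ⟧ S = lit s x S

Avoids : ∀ {n} → Fin n → Form n → Set
Avoids a (constF s) = ⊤
Avoids a (litF s x) = x ≢ a

lit-in : ∀ {n} s (x : Fin n) {S} → mem x S ≡ true → lit s x S ≡ s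
lit-in true  x x∈S = x∈S
lit-in false x x∈S = cong not x∈S

lit-out : ∀ {n} s (x : Fin n) {S} → mem x S ≡ false → lit s x S ≡ not s
lit-out true  x x∉S = x∉S
lit-out false x x∉S = cong not x∉S

AgreeThrough : ∀ {n} → ℕ → Fin n → Fin n → Form n → Form n → Set
AgreeThrough {n} K a b φ ψ =
  ∀ (S : Subset n) → ∣ S ∣ ≡ K → mem a S ≡ true → mem b S ≡ true → ⟦ φ ⟧ S ≡ ⟦ ψ ⟧ S

absorbˡ : ∀ {n K s} {a b : Fin n} {ψ} →
          AgreeThrough K a b (litF s b) ψ → AgreeThrough K a b (constF s) ψ
absorbˡ {s = s} {b = b} agree S ∣S∣ a∈S b∈S = trans (sym (lit-in s b b∈S)) (agree S ∣S∣ a∈S b∈S)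

absorbʳ : ∀ {n K t} {a b : Fin n} {φ} →
          AgreeThrough K a b φ (litF t a) → AgreeThrough K a b φ (constF t)
absorbʳ {t = t} {a = a} agree S ∣S∣ a∈S b∈S = trans (agree S ∣S∣ a∈S b∈S) (lit-in t a a∈S)

data Compatible {n} (a b : Fin n) : Form n → Form n → Set where
  both-const : ∀ s → Compatible a b (constF s) (constF s)
  both-lit   : ∀ s x → x ≢ a → x ≢ b → Compatible a b (litF s x) (litF s x)
  const-lit  : ∀ s → Compatible a b (constF s) (litF s a)
  lit-const  : ∀ s → Compatible a b (litF s b) (constF s)
  crossed    : ∀ s → Compatible a b (litF s b) (litF s a)

module _ {n K : ℕ} (3≤K : 3 ≤ K) (K+2≤n : K + 2 ≤ n) where

  -- 'choose' with at most three members and two non-members, which always fit.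
  -- The length bounds are decided by computation, so they are inferred at use sites.
  pick : (ins outs : List (Fin n)) {_ : T (length ins ≤ᵇ 3)} {_ : T (length outs ≤ᵇ 2)} →
         Disjoint ins outs →
         Σ[ S ∈ Subset n ] ∣ S ∣ ≡ K × All (λ x → mem x S ≡ true) ins
                                     × All (λ y → mem y S ≡ false) outs
  pick ins outs {ins≤3} {outs≤2} = choose K ins outs
    (≤-trans (≤ᵇ⇒≤ _ 3 ins≤3) 3≤K) (≤-trans (+-monoʳ-≤ K (≤ᵇ⇒≤ _ 2 outs≤2)) K+2≤n)

  -- Some point differs from two given ones: a K-set avoiding both is nonempty.
  third : (a b : Fin n) → Σ[ c ∈ Fin n ] c ≢ a × c ≢ b
  third a b with pick [] (a ∷ b ∷ []) ([] ∷ [] ∷ [])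
  ... | S , ∣S∣≡K , [] , a∉S ∷ b∉S ∷ [] with nonempty? S
  ...   | yes (c , c∈S) = c , (λ { refl → not-¬ ([]=⇒lookup c∈S) a∉S })
                            , (λ { refl → not-¬ ([]=⇒lookup c∈S) b∉S })
  ...   | no S-empty    = ⊥-elim (<⇒≢ (≤-trans (s≤s z≤n) 3≤K) (trans (sym ∣S∣≡0) ∣S∣≡K))
    where
    ∣S∣≡0 : ∣ S ∣ ≡ 0
    ∣S∣≡0 = trans (cong ∣_∣ (Empty-unique S-empty)) (∣⊥∣≡0 n)

  -- Differing forms are told apart by a set containing a, b and at most one
  -- variable, and one omitting the variable(s).
  separate : (a b : Fin n) (φ ψ : Form n) →
             Avoids a φ × Avoids b φ → Avoids a ψ × Avoids b ψ →
             AgreeThrough K a b φ ψ → φ ≡ ψ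
  separate a b (constF s) (constF t) _ _ agree with pick (a ∷ b ∷ []) [] []
  ... | S , ∣S∣ , a∈S ∷ b∈S ∷ [] , [] = cong constF (agree S ∣S∣ a∈S b∈S)
  separate a b (constF s) (litF t y) _ (y≢a , y≢b) agree
    with pick (a ∷ b ∷ y ∷ []) [] []
       | pick (a ∷ b ∷ []) (y ∷ []) ((y≢a ∷ y≢b ∷ []) ∷ [])
  ... | S₁ , ∣S₁∣ , a∈S₁ ∷ b∈S₁ ∷ y∈S₁ ∷ [] , []
      | S₂ , ∣S₂∣ , a∈S₂ ∷ b∈S₂ ∷ [] , y∉S₂ ∷ [] =
    ⊥-elim (not-¬ (trans (agree S₁ ∣S₁∣ a∈S₁ b∈S₁) (lit-in t y y∈S₁))
                  (trans (agree S₂ ∣S₂∣ a∈S₂ b∈S₂) (lit-out t y y∉S₂)))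
  separate a b (litF s x) (constF t) φ-avoids ψ-avoids agree =
    sym (separate a b (constF t) (litF s x) ψ-avoids φ-avoids
           (λ S ∣S∣ a∈S b∈S → sym (agree S ∣S∣ a∈S b∈S)))
  separate a b (litF s x) (litF t y) (x≢a , x≢b) (y≢a , y≢b) agree with x ≟ y
  ... | yes refl with pick (a ∷ b ∷ x ∷ []) [] []
  ...   | S , ∣S∣ , a∈S ∷ b∈S ∷ x∈S ∷ [] , [] =
    cong (λ u → litF u x)
      (trans (sym (lit-in s x x∈S)) (trans (agree S ∣S∣ a∈S b∈S) (lit-in t x x∈S)))
  separate a b (litF s x) (litF t y) (x≢a , x≢b) (y≢a , y≢b) agree | no x≢y
    with pick (a ∷ b ∷ x ∷ []) (y ∷ []) ((y≢a ∷ y≢b ∷ ≢-sym x≢y ∷ []) ∷ [])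
       | pick (a ∷ b ∷ []) (x ∷ y ∷ []) ((x≢a ∷ x≢b ∷ []) ∷ (y≢a ∷ y≢b ∷ []) ∷ [])
  ... | S₁ , ∣S₁∣ , a∈S₁ ∷ b∈S₁ ∷ x∈S₁ ∷ [] , y∉S₁ ∷ []
      | S₂ , ∣S₂∣ , a∈S₂ ∷ b∈S₂ ∷ [] , x∉S₂ ∷ y∉S₂ ∷ [] =
    ⊥-elim (not-¬ s≡t s≡¬t)
    where
    s≡t : s ≡ t
    s≡t = not-injective (trans (sym (lit-out s x x∉S₂))
                               (trans (agree S₂ ∣S₂∣ a∈S₂ b∈S₂) (lit-out t y y∉S₂)))
    s≡¬t : s ≡ not t
    s≡¬t = trans (sym (lit-in s x x∈S₁)) (trans (agree S₁ ∣S₁∣ a∈S₁ b∈S₁) (lit-out t y y∉S₁))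

  compatible : (a b : Fin n) (φ ψ : Form n) → Avoids a φ → Avoids b ψ →
               AgreeThrough K a b φ ψ → Compatible a b φ ψ
  compatible a b (constF s) (constF t) _ _ agree
    with separate a b (constF s) (constF t) _ _ agree
  ... | refl = both-const s
  compatible a b (constF s) (litF t y) _ y≢b agree with y ≟ a
  ... | yes refl with separate a b (constF s) (constF t) _ _ (absorbʳ {φ = constF s} agree)
  ...   | refl = const-lit s
  compatible a b (constF s) (litF t y) _ y≢b agree | no y≢a
    with separate a b (constF s) (litF t y) _ (y≢a , y≢b) agree
  ... | ()
  compatible a b (litF s x) (constF t) x≢a _ agree with x ≟ b
  ... | yes refl with separate a b (constF s) (constF t) _ _ (absorbˡ {ψ = constF t} agree)
  ...   | refl = lit-const s
  compatible a b (litF s x) (constF t) x≢a _ agree | no x≢b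
    with separate a b (litF s x) (constF t) (x≢a , x≢b) _ agree
  ... | ()
  compatible a b (litF s x) (litF t y) x≢a y≢b agree with x ≟ b | y ≟ a
  ... | yes refl | yes refl
    with separate a b (constF s) (constF t) _ _ (absorbˡ {ψ = constF t} (absorbʳ {φ = litF s b} agree))
  ...   | refl = crossed s
  compatible a b (litF s x) (litF t y) x≢a y≢b agree | yes refl | no y≢a
    with separate a b (constF s) (litF t y) _ (y≢a , y≢b) (absorbˡ {ψ = litF t y} agree)
  ... | ()
  compatible a b (litF s x) (litF t y) x≢a y≢b agree | no x≢b | yes refl
    with separate a b (litF s x) (constF t) (x≢a , x≢b) _ (absorbʳ {φ = litF s x} agree)
  ... | ()
  compatible a b (litF s x) (litF t y) x≢a y≢b agree | no x≢b | no y≢a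
    with separate a b (litF s x) (litF t y) (x≢a , x≢b) (y≢a , y≢b) agree
  ... | refl = both-lit s x x≢a x≢b

sumFin-cong : ∀ n {g h : Fin n → ℚ} → (∀ i → g i ≡ h i) → sumFin n g ≡ sumFin n h
sumFin-cong zero    g≗h = refl
sumFin-cong (suc n) g≗h = cong₂ ℚ._+_ (g≗h zero) (sumFin-cong n (λ i → g≗h (suc i)))

sumFin-punchIn : ∀ N (h : Fin (suc N) → ℚ) (a : Fin (suc N)) →
                 sumFin (suc N) h ≡ h a ℚ.+ sumFin N (λ j → h (punchIn a j))
sumFin-punchIn N       h zero    = refl
sumFin-punchIn (suc N) h (suc a) = begin
  h zero ℚ.+ sumFin (suc N) (λ i → h (suc i))
    ≡⟨ cong (λ u → h zero ℚ.+ u) (sumFin-punchIn N (λ i → h (suc i)) a) ⟩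
  h zero ℚ.+ (h (suc a) ℚ.+ rest)
    ≡⟨ sym (ℚ.+-assoc (h zero) (h (suc a)) rest) ⟩
  (h zero ℚ.+ h (suc a)) ℚ.+ rest
    ≡⟨ cong (λ u → u ℚ.+ rest) (ℚ.+-comm (h zero) (h (suc a))) ⟩
  (h (suc a) ℚ.+ h zero) ℚ.+ rest
    ≡⟨ ℚ.+-assoc (h (suc a)) (h zero) rest ⟩
  h (suc a) ℚ.+ (h zero ℚ.+ rest)
    ∎
  where
  open ≡-Reasoning
  rest = sumFin N (λ j → h (suc (punchIn a j)))

∣insertAt∣ : ∀ {N} (T : Subset N) (a : Fin (suc N)) → ∣ insertAt T a true ∣ ≡ suc ∣ T ∣
∣insertAt∣ T           zero    = refl
∣insertAt∣ (true ∷ T)  (suc a) = cong suc (∣insertAt∣ T a)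
∣insertAt∣ (false ∷ T) (suc a) = ∣insertAt∣ T a

insert-remove : ∀ {N} (S : Subset (suc N)) a → mem a S ≡ true → insertAt (removeAt S a) a true ≡ S
insert-remove S a a∈S = trans (cong (insertAt (removeAt S a) a) (sym a∈S)) (insertAt-removeAt S a)

∣removeAt∣ : ∀ {N k} (S : Subset (suc N)) a → ∣ S ∣ ≡ suc k → mem a S ≡ true → ∣ removeAt S a ∣ ≡ k
∣removeAt∣ S a ∣S∣ a∈S =
  ℕ.suc-injective (trans (sym (∣insertAt∣ (removeAt S a) a)) (trans (cong ∣_∣ (insert-remove S a a∈S)) ∣S∣))

-- The restriction f_a, read on J(N, k), is again Boolean of degree 1: the coefficient
-- of a is absorbed into the constant.
restriction-deg1 : ∀ N k (f : Subset (suc N) → Bool) → IsBoolDeg1 (suc N) (suc k) f →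
                   (a : Fin (suc N)) → IsBoolDeg1 N k (λ T → f (insertAt T a true))
restriction-deg1 N k f (c , cs , f≡) a = c ℚ.+ cs a , (λ j → cs (punchIn a j)) , λ T ∣T∣ →
  let S = insertAt T a true
      term = λ i → cs i ℚ.* ind (mem i S)
      rest = sumFin N (λ j → term (punchIn a j))
  in begin
    ind (f S)
      ≡⟨ f≡ S (trans (∣insertAt∣ T a) (cong suc ∣T∣)) ⟩
    c ℚ.+ sumFin (suc N) term
      ≡⟨ cong (λ u → c ℚ.+ u) (sumFin-punchIn N term a) ⟩
    c ℚ.+ (cs a ℚ.* ind (mem a S) ℚ.+ rest)
      ≡⟨ cong (λ u → c ℚ.+ (cs a ℚ.* ind u ℚ.+ rest)) (insertAt-lookup T a true) ⟩
    c ℚ.+ (cs a ℚ.* 1ℚ ℚ.+ rest)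
      ≡⟨ cong (λ u → c ℚ.+ (u ℚ.+ rest)) (ℚ.*-identityʳ (cs a)) ⟩
    c ℚ.+ (cs a ℚ.+ rest)
      ≡⟨ sym (ℚ.+-assoc c (cs a) rest) ⟩
    (c ℚ.+ cs a) ℚ.+ rest
      ≡⟨ cong (λ u → (c ℚ.+ cs a) ℚ.+ u)
              (sumFin-cong N (λ j → cong (λ u → cs (punchIn a j) ℚ.* ind u) (insertAt-punchIn T a true j))) ⟩
    (c ℚ.+ cs a) ℚ.+ sumFin N (λ j → cs (punchIn a j) ℚ.* ind (mem j T))
      ∎
  where open ≡-Reasoning

trivial-form : ∀ {N k} → OnlyTrivial N k → (g : Subset N → Bool) → IsBoolDeg1 N k g →
               Σ[ ψ ∈ Form N ] EqOn N k g ⟦ ψ ⟧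
trivial-form trivial g g-deg1 with trivial g g-deg1
... | inj₁ (s , g≡s)       = constF s , g≡s
... | inj₂ (s , x , g≡lit) = litF s x , g≡lit

liftF : ∀ {N} → Fin (suc N) → Form N → Form (suc N)
liftF a (constF s) = constF s
liftF a (litF s y) = litF s (punchIn a y)

liftF-avoids : ∀ {N} (a : Fin (suc N)) (ψ : Form N) → Avoids a (liftF a ψ)
liftF-avoids a (constF s) = _
liftF-avoids a (litF s y) = punchInᵢ≢i a y

⟦liftF⟧ : ∀ {N} (a : Fin (suc N)) (ψ : Form N) (T : Subset N) →
          ⟦ liftF a ψ ⟧ (insertAt T a true) ≡ ⟦ ψ ⟧ T
⟦liftF⟧ a (constF s)     T = refl
⟦liftF⟧ a (litF true y)  T = insertAt-punchIn T a true y
⟦liftF⟧ a (litF false y) T = cong not (insertAt-punchIn T a true y)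

LocalForm : (n K : ℕ) → (Subset n → Bool) → Fin n → Set
LocalForm n K f a = Σ[ φ ∈ Form n ] Avoids a φ × EqRestr n K f a ⟦ φ ⟧

local-form : ∀ {N k} → OnlyTrivial N k → (f : Subset (suc N) → Bool) →
             IsBoolDeg1 (suc N) (suc k) f → (a : Fin (suc N)) → LocalForm (suc N) (suc k) f a
local-form {N} {k} trivial f f-deg1 a with trivial-form trivial _ (restriction-deg1 N k f f-deg1 a)
... | ψ , f_a≡ψ = liftF a ψ , liftF-avoids a ψ , agrees
  where
  agrees : EqRestr (suc N) (suc k) f a ⟦ liftF a ψ ⟧
  agrees S ∣S∣ a∈S = begin
    f S                                            ≡⟨ cong f (sym (insert-remove S a a∈S)) ⟩
    f (insertAt (removeAt S a) a true)             ≡⟨ f_a≡ψ (removeAt S a) (∣removeAt∣ S a ∣S∣ a∈S) ⟩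
    ⟦ ψ ⟧ (removeAt S a)                           ≡⟨ sym (⟦liftF⟧ a ψ (removeAt S a)) ⟩
    ⟦ liftF a ψ ⟧ (insertAt (removeAt S a) a true) ≡⟨ cong ⟦ liftF a ψ ⟧ (insert-remove S a a∈S) ⟩
    ⟦ liftF a ψ ⟧ S                                ∎
    where open ≡-Reasoning

agreement : ∀ {n K} (f : Subset n → Bool) {a b : Fin n} (φ ψ : Form n) →
            EqRestr n K f a ⟦ φ ⟧ → EqRestr n K f b ⟦ ψ ⟧ → AgreeThrough K a b φ ψ
agreement f φ ψ f_a≡φ f_b≡ψ S ∣S∣ a∈S b∈S = trans (sym (f_a≡φ S ∣S∣ a∈S)) (f_b≡ψ S ∣S∣ b∈S)

PairOutcome : (n K : ℕ) → (Subset n → Bool) → Fin n → Fin n → Set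
PairOutcome n K f a b =
    (Σ Bool λ s → EqRestr n K f a (λ _ → s) × EqRestr n K f b (λ _ → s))
  ⊎ ((Σ Bool λ s → Σ (Fin n) λ x → x ≢ a × x ≢ b
        × EqRestr n K f a (lit s x) × EqRestr n K f b (lit s x))
  ⊎ (Σ Bool λ s → (EqRestr n K f a (λ _ → s) × EqRestr n K f b (lit s a))
                 ⊎ (EqRestr n K f b (λ _ → s) × EqRestr n K f a (lit s b))))

module _ {n K : ℕ} (3≤K : 3 ≤ K) (K+2≤n : K + 2 ≤ n)
         (f : Subset n → Bool) (form : ∀ c → LocalForm n K f c) where

  -- f_a = b^s and f_b = a^s cannot both hold: seen from a, a third point c must carry
  -- f_c = b^s, which seen from b is incompatible with f_b = a^s.
  no-crossing : ∀ {a b s} → a ≢ b → EqRestr n K f a ⟦ litF s b ⟧ → EqRestr n K f b ⟦ litF s a ⟧ → ⊥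
  no-crossing {a} {b} {s} a≢b f_a≡bˢ f_b≡aˢ with third 3≤K K+2≤n a b
  ... | c , c≢a , c≢b with form c
  ... | φ , φ-avoids-c , f_c≡φ
    with compatible 3≤K K+2≤n a c (litF s b) φ (≢-sym a≢b) φ-avoids-c (agreement f (litF s b) φ f_a≡bˢ f_c≡φ)
  ... | lit-const _ = c≢b refl
  ... | crossed _   = c≢b refl
  ... | both-lit _ _ _ _
    with compatible 3≤K K+2≤n b c (litF s a) (litF s b) a≢b φ-avoids-c
                    (agreement f (litF s a) (litF s b) f_b≡aˢ f_c≡φ)
  ...   | both-lit _ _ _ _ = a≢b refl
  ...   | crossed _        = c≢a refl

  pair-outcome : (a b : Fin n) → a ≢ b → PairOutcome n K f a b
  pair-outcome a b a≢b with form a | form b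
  ... | φ , φ-avoids-a , f_a≡φ | ψ , ψ-avoids-b , f_b≡ψ
    with compatible 3≤K K+2≤n a b φ ψ φ-avoids-a ψ-avoids-b (agreement f φ ψ f_a≡φ f_b≡ψ)
  ... | both-const s         = inj₁ (s , f_a≡φ , f_b≡ψ)
  ... | both-lit s x x≢a x≢b = inj₂ (inj₁ (s , x , x≢a , x≢b , f_a≡φ , f_b≡ψ))
  ... | const-lit s          = inj₂ (inj₂ (s , inj₁ (f_a≡φ , f_b≡ψ)))
  ... | lit-const s          = inj₂ (inj₂ (s , inj₂ (f_b≡ψ , f_a≡φ)))
  ... | crossed s            = ⊥-elim (no-crossing {s = s} a≢b f_a≡φ f_b≡ψ)

lemma3p1 : (k ℓ : ℕ) → 2 ≤ k → 2 ≤ ℓ → OnlyTrivial (k + ℓ) k →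
    (f : Subset (k + ℓ + 1) → Bool) → IsBoolDeg1 (k + ℓ + 1) (k + 1) f →
    (a b : Fin (k + ℓ + 1)) → a ≢ b →
    (Σ Bool λ s → EqRestr (k + ℓ + 1) (k + 1) f a (λ _ → s)
                × EqRestr (k + ℓ + 1) (k + 1) f b (λ _ → s))
    ⊎ ((Σ Bool λ s → Σ (Fin (k + ℓ + 1)) λ x → x ≢ a × x ≢ b
          × EqRestr (k + ℓ + 1) (k + 1) f a (lit s x)
          × EqRestr (k + ℓ + 1) (k + 1) f b (lit s x))
    ⊎ (Σ Bool λ s →
          (EqRestr (k + ℓ + 1) (k + 1) f a (λ _ → s)
           × EqRestr (k + ℓ + 1) (k + 1) f b (lit s a))
        ⊎ (EqRestr (k + ℓ + 1) (k + 1) f b (λ _ → s)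
           × EqRestr (k + ℓ + 1) (k + 1) f a (lit s b))))
lemma3p1 k ℓ 2≤k 2≤ℓ trivial f f-deg1 =
  pair-outcome 3≤K K+2≤n f (forms (ℕ.+-comm (k + ℓ) 1) (ℕ.+-comm k 1) f f-deg1)
  where
  3≤K : 3 ≤ k + 1
  3≤K = +-monoˡ-≤ 1 2≤k
  K+2≤n : k + 1 + 2 ≤ k + ℓ + 1
  K+2≤n = ≤-trans (≤-reflexive (trans (ℕ.+-assoc k 1 2) (sym (ℕ.+-assoc k 2 1))))
                  (+-monoˡ-≤ 1 (+-monoʳ-≤ k 2≤ℓ))
  -- every restriction has a local form, once n = (k+ℓ)+1 and K = k+1 are seen as successors
  forms : ∀ {n K} → n ≡ suc (k + ℓ) → K ≡ suc k →
          (g : Subset n → Bool) → IsBoolDeg1 n K g → ∀ c → LocalForm n K g c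
  forms refl refl = local-form trivial
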